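{- Let $t$ be an indeterminate (equivalently, an arbitrary rational or integer parameter), and define the polynomials \[ \begin{aligned} x_1 &= 2t^4 + 42t^3 - 170t^2 + 942t - 48, & x_2 &= t^4 - 84t^3 - 242t^2 - 68t - 1911,\\ x_3 &= 5t^4 + 12t^3 - 10t^2 + 1724t + 1341, & x_4 &= 3t^4 - 58t^3 + 92t^2 - 310t - 1263,\\ y_1 &= 3t^4 - 16t^3 - 170t^2 - 1320t - 1569, & y_2 &= 2t^4 - 86t^3 - 106t^2 - 146t + 1872,\\ y_3 &= 5t^4 + 10t^3 + 164t^2 - 1562t - 921, & y_4 &= t^4 + 56t^3 + 266t^2 + 928t - 483. \end{aligned} \] Then $\sum_{i=1}^4 x_i^r=\sum_{i=1}^4 y_i^r$ holds identically in $t$ for $r=2,4,6$. Consequently, setting $x_{i+4}=-x_i$ and $y_{i+4}=-y_i$ for $i=1,\dots,4$, one has $\sum_{i=1}^8 x_i^r=\sum_{i=1}^8 y_i^r$ identically in $t$ for $r=1,2,\dots,7$, i.e. these give a parametric ideal solution of degree 4 of the Tarry–Escott problem of degree 7.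
   Context: The Tarry–Escott problem of degree $k$ asks for two distinct multisets of integers $\{x_1,\dots,x_s\}$ and $\{y_1,\dots,y_s\}$ with $\sum_{i=1}^s x_i^r=\sum_{i=1}^s y_i^r$ for $r=1,\dots,k$; a solution with $s=k+1$ is called ideal. -}

module Defs where

open import Data.Nat using (ℕ)
open import Data.Integer using (ℤ; +_; -_; _+_; _-_; _*_; _^_)
open import Data.List using (List; []; _∷_; map; foldr; _++_)

powSum : ℕ → List ℤ → ℤ
powSum r as = foldr _+_ (+ 0) (map (λ a → a ^ r) as)

x₁ x₂ x₃ x₄ y₁ y₂ y₃ y₄ : ℤ → ℤ
x₁ t = + 2 * t ^ 4 + + 42 * t ^ 3 - + 170 * t ^ 2 + + 942 * t - + 48
x₂ t = t ^ 4 - + 84 * t ^ 3 - + 242 * t ^ 2 - + 68 * t - + 1911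
x₃ t = + 5 * t ^ 4 + + 12 * t ^ 3 - + 10 * t ^ 2 + + 1724 * t + + 1341
x₄ t = + 3 * t ^ 4 - + 58 * t ^ 3 + + 92 * t ^ 2 - + 310 * t - + 1263
y₁ t = + 3 * t ^ 4 - + 16 * t ^ 3 - + 170 * t ^ 2 - + 1320 * t - + 1569
y₂ t = + 2 * t ^ 4 - + 86 * t ^ 3 - + 106 * t ^ 2 - + 146 * t + + 1872
y₃ t = + 5 * t ^ 4 + + 10 * t ^ 3 + + 164 * t ^ 2 - + 1562 * t - + 921
y₄ t = t ^ 4 + + 56 * t ^ 3 + + 266 * t ^ 2 + + 928 * t - + 483

xs4 ys4 : ℤ → List ℤ
xs4 t = x₁ t ∷ x₂ t ∷ x₃ t ∷ x₄ t ∷ []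
ys4 t = y₁ t ∷ y₂ t ∷ y₃ t ∷ y₄ t ∷ []

xs8 ys8 : ℤ → List ℤ
xs8 t = xs4 t ++ map -_ (xs4 t)
ys8 t = ys4 t ++ map -_ (ys4 t)

-- The four-term identities are polynomial identities of degree at most 24 in t. They are
-- verified by normalising both sides to coefficient lists, which is sound because evaluating
-- a coefficient list (Horner's scheme) is a ring homomorphism. For the eight-term lists,
-- -a contributes (-a)^r = a^r for even r and -a^r for odd r, so every odd power sum
-- of as ++ map -_ as vanishes and every even one is twice that of as.
module Submission where

open import Defs
open import Data.Nat using (ℕ; zero; suc; _≤_; s≤s)
import Data.Nat as ℕ
open import Data.Integer using (ℤ; +_; -_; _+_; _-_; _*_; _^_)
import Data.Integer as ℤ
open import Data.Integer.Properties
  using (+-identityˡ; +-identityʳ; *-zeroʳ; +-assoc; +-inverseʳ; neg-distribˡ-*; neg-distrib-+; ^-*-assoc)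
open import Data.Integer.Tactic.RingSolver using (solve-∀)
open import Data.List using (List; []; _∷_; map; foldr; _++_)
open import Data.List.Properties using (≡-dec)
open import Data.List.Membership.Propositional using (_∈_; _∉_)
open import Data.List.Membership.DecPropositional ℤ._≟_ using (_∈?_)
open import Data.List.Relation.Unary.Any using (here)
open import Data.List.Relation.Binary.Permutation.Propositional using (_↭_)
open import Data.List.Relation.Binary.Permutation.Propositional.Properties using (∈-resp-↭)
open import Data.Product using (_×_; _,_; ∃-syntax)
open import Relation.Nullary using (¬_)
open import Relation.Nullary.Decidable using (True; toWitness; toWitnessFalse)
open import Relation.Binary.Definitions using (DecidableEquality)
open import Relation.Binary.PropositionalEquality using (_≡_; refl; sym; trans; cong; cong₂; module ≡-Reasoning)

open ≡-Reasoning

-- Polynomials over ℤ as coefficient lists, constant term first.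
Poly : Set
Poly = List ℤ

eval : Poly → ℤ → ℤ
eval []      t = + 0
eval (a ∷ p) t = a + t * eval p t

infixl 6 _+ₚ_
infixl 7 _·ₚ_ _*ₚ_
infixr 8 _^ₚ_

_+ₚ_ : Poly → Poly → Poly
[]      +ₚ q       = q
(a ∷ p) +ₚ []      = a ∷ p
(a ∷ p) +ₚ (b ∷ q) = a + b ∷ p +ₚ q

_·ₚ_ : ℤ → Poly → Poly
c ·ₚ p = map (c *_) p

_*ₚ_ : Poly → Poly → Poly
[]      *ₚ q = []
(a ∷ p) *ₚ q = a ·ₚ q +ₚ (+ 0 ∷ p *ₚ q)

_^ₚ_ : Poly → ℕ → Poly
p ^ₚ zero  = + 1 ∷ []
p ^ₚ suc n = p *ₚ p ^ₚ n

eval-+ₚ : ∀ p q t → eval (p +ₚ q) t ≡ eval p t + eval q t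
eval-+ₚ []      q       t = sym (+-identityˡ (eval q t))
eval-+ₚ (a ∷ p) []      t = sym (+-identityʳ (a + t * eval p t))
eval-+ₚ (a ∷ p) (b ∷ q) t = begin
  a + b + t * eval (p +ₚ q) t            ≡⟨ cong (λ x → a + b + t * x) (eval-+ₚ p q t) ⟩
  a + b + t * (eval p t + eval q t)      ≡⟨ interchange a b t (eval p t) (eval q t) ⟩
  a + t * eval p t + (b + t * eval q t)  ∎
  where
  interchange : ∀ a b t x y → a + b + t * (x + y) ≡ a + t * x + (b + t * y)
  interchange = solve-∀

eval-·ₚ : ∀ c p t → eval (c ·ₚ p) t ≡ c * eval p t
eval-·ₚ c []      t = sym (*-zeroʳ c)
eval-·ₚ c (a ∷ p) t = begin
  c * a + t * eval (c ·ₚ p) t  ≡⟨ cong (λ x → c * a + t * x) (eval-·ₚ c p t) ⟩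
  c * a + t * (c * eval p t)   ≡⟨ distrib c a t (eval p t) ⟩
  c * (a + t * eval p t)       ∎
  where
  distrib : ∀ c a t x → c * a + t * (c * x) ≡ c * (a + t * x)
  distrib = solve-∀

eval-*ₚ : ∀ p q t → eval (p *ₚ q) t ≡ eval p t * eval q t
eval-*ₚ []      q t = refl
eval-*ₚ (a ∷ p) q t = begin
  eval (a ·ₚ q +ₚ (+ 0 ∷ p *ₚ q)) t                 ≡⟨ eval-+ₚ (a ·ₚ q) (+ 0 ∷ p *ₚ q) t ⟩
  eval (a ·ₚ q) t + (+ 0 + t * eval (p *ₚ q) t)     ≡⟨ cong₂ (λ x y → x + (+ 0 + t * y)) (eval-·ₚ a q t) (eval-*ₚ p q t) ⟩
  a * eval q t + (+ 0 + t * (eval p t * eval q t))  ≡⟨ distrib a t (eval p t) (eval q t) ⟩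
  (a + t * eval p t) * eval q t                     ∎
  where
  distrib : ∀ a t x y → a * y + (+ 0 + t * (x * y)) ≡ (a + t * x) * y
  distrib = solve-∀

eval-^ₚ : ∀ p n t → eval (p ^ₚ n) t ≡ eval p t ^ n
eval-^ₚ p zero    t = cong (_+_ (+ 1)) (*-zeroʳ t)
eval-^ₚ p (suc n) t = trans (eval-*ₚ p (p ^ₚ n) t) (cong (eval p t *_) (eval-^ₚ p n t))

infixl 6 _:+_ _:-_
infixl 7 _:*_
infixr 8 _:^_

data Expr : Set where
  var              : Expr
  con              : ℤ → Expr
  _:+_ _:-_ _:*_   : Expr → Expr → Expr
  _:^_             : Expr → ℕ → Expr

⟦_⟧ : Expr → ℤ → ℤ
⟦ var    ⟧ t = t
⟦ con c  ⟧ t = c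
⟦ e :+ f ⟧ t = ⟦ e ⟧ t + ⟦ f ⟧ t
⟦ e :- f ⟧ t = ⟦ e ⟧ t - ⟦ f ⟧ t
⟦ e :* f ⟧ t = ⟦ e ⟧ t * ⟦ f ⟧ t
⟦ e :^ n ⟧ t = ⟦ e ⟧ t ^ n

normalise : Expr → Poly
normalise var      = + 0 ∷ + 1 ∷ []
normalise (con c)  = c ∷ []
normalise (e :+ f) = normalise e +ₚ normalise f
normalise (e :- f) = normalise e +ₚ (- + 1) ·ₚ normalise f
normalise (e :* f) = normalise e *ₚ normalise f
normalise (e :^ n) = normalise e ^ₚ n

eval-normalise : ∀ e t → eval (normalise e) t ≡ ⟦ e ⟧ t
eval-normalise var      t = linear t
  where
  linear : ∀ t → + 0 + t * (+ 1 + t * + 0) ≡ t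
  linear = solve-∀
eval-normalise (con c)  t = trans (cong (_+_ c) (*-zeroʳ t)) (+-identityʳ c)
eval-normalise (e :+ f) t = trans (eval-+ₚ (normalise e) (normalise f) t)
                                  (cong₂ _+_ (eval-normalise e t) (eval-normalise f t))
eval-normalise (e :- f) t = begin
  eval (normalise e +ₚ (- + 1) ·ₚ normalise f) t           ≡⟨ eval-+ₚ (normalise e) _ t ⟩
  eval (normalise e) t + eval ((- + 1) ·ₚ normalise f) t   ≡⟨ cong (_+_ (eval (normalise e) t)) (eval-·ₚ (- + 1) (normalise f) t) ⟩
  eval (normalise e) t + (- + 1) * eval (normalise f) t    ≡⟨ cong₂ (λ x y → x + (- + 1) * y) (eval-normalise e t) (eval-normalise f t) ⟩
  ⟦ e ⟧ t + (- + 1) * ⟦ f ⟧ t                               ≡⟨ minus (⟦ e ⟧ t) (⟦ f ⟧ t) ⟩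
  ⟦ e ⟧ t - ⟦ f ⟧ t                                         ∎
  where
  minus : ∀ x y → x + (- + 1) * y ≡ x - y
  minus = solve-∀
eval-normalise (e :* f) t = trans (eval-*ₚ (normalise e) (normalise f) t)
                                  (cong₂ _*_ (eval-normalise e t) (eval-normalise f t))
eval-normalise (e :^ n) t = trans (eval-^ₚ (normalise e) n t) (cong (_^ n) (eval-normalise e t))

powSumₚ : ℕ → List Poly → Poly
powSumₚ r ps = foldr _+ₚ_ [] (map (_^ₚ r) ps)

powSum-normalise : ∀ r es t →
  eval (powSumₚ r (map normalise es)) t ≡ powSum r (map (λ e → ⟦ e ⟧ t) es)
powSum-normalise r []       t = refl
powSum-normalise r (e ∷ es) t = begin
  eval (normalise e ^ₚ r +ₚ powSumₚ r (map normalise es)) t             ≡⟨ eval-+ₚ (normalise e ^ₚ r) _ t ⟩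
  eval (normalise e ^ₚ r) t + eval (powSumₚ r (map normalise es)) t     ≡⟨ cong₂ _+_ (eval-^ₚ (normalise e) r t) (powSum-normalise r es t) ⟩
  eval (normalise e) t ^ r + powSum r (map (λ e → ⟦ e ⟧ t) es)          ≡⟨ cong (λ x → x ^ r + _) (eval-normalise e t) ⟩
  ⟦ e ⟧ t ^ r + powSum r (map (λ e → ⟦ e ⟧ t) es)                       ∎

powSum-identity : ∀ r es fs → powSumₚ r (map normalise es) ≡ powSumₚ r (map normalise fs) →
  ∀ t → powSum r (map (λ e → ⟦ e ⟧ t) es) ≡ powSum r (map (λ e → ⟦ e ⟧ t) fs)
powSum-identity r es fs eq t = begin
  powSum r (map (λ e → ⟦ e ⟧ t) es)    ≡⟨ powSum-normalise r es t ⟨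
  eval (powSumₚ r (map normalise es)) t ≡⟨ cong (λ p → eval p t) eq ⟩
  eval (powSumₚ r (map normalise fs)) t ≡⟨ powSum-normalise r fs t ⟩
  powSum r (map (λ e → ⟦ e ⟧ t) fs)    ∎

_≟ₚ_ : DecidableEquality Poly
_≟ₚ_ = ≡-dec ℤ._≟_

mirror : List ℤ → List ℤ
mirror as = as ++ map -_ as

powSum-++ : ∀ r as bs → powSum r (as ++ bs) ≡ powSum r as + powSum r bs
powSum-++ r []       bs = sym (+-identityˡ (powSum r bs))
powSum-++ r (a ∷ as) bs = trans (cong (_+_ (a ^ r)) (powSum-++ r as bs)) (sym (+-assoc (a ^ r) _ _))

neg-^-even : ∀ k a → (- a) ^ (2 ℕ.* k) ≡ a ^ (2 ℕ.* k)
neg-^-even k a = begin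
  (- a) ^ (2 ℕ.* k)  ≡⟨ ^-*-assoc (- a) 2 k ⟨
  ((- a) ^ 2) ^ k    ≡⟨ cong (_^ k) (neg-square a) ⟩
  (a ^ 2) ^ k        ≡⟨ ^-*-assoc a 2 k ⟩
  a ^ (2 ℕ.* k)      ∎
  where
  -- (- a) ^ 2 ≡ a ^ 2, unfolded because the ring solver does not interpret ℤ's _^_
  neg-square : ∀ a → - a * (- a * + 1) ≡ a * (a * + 1)
  neg-square = solve-∀

neg-^-odd : ∀ k a → (- a) ^ suc (2 ℕ.* k) ≡ - (a ^ suc (2 ℕ.* k))
neg-^-odd k a = trans (cong ((- a) *_) (neg-^-even k a)) (sym (neg-distribˡ-* a (a ^ (2 ℕ.* k))))

powSum-neg-even : ∀ k as → powSum (2 ℕ.* k) (map -_ as) ≡ powSum (2 ℕ.* k) as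
powSum-neg-even k []       = refl
powSum-neg-even k (a ∷ as) = cong₂ _+_ (neg-^-even k a) (powSum-neg-even k as)

powSum-neg-odd : ∀ k as → powSum (suc (2 ℕ.* k)) (map -_ as) ≡ - powSum (suc (2 ℕ.* k)) as
powSum-neg-odd k []       = refl
powSum-neg-odd k (a ∷ as) = trans (cong₂ _+_ (neg-^-odd k a) (powSum-neg-odd k as))
                                  (sym (neg-distrib-+ (a ^ suc (2 ℕ.* k)) (powSum (suc (2 ℕ.* k)) as)))

mirror-powSum-even : ∀ k as → powSum (2 ℕ.* k) (mirror as) ≡ powSum (2 ℕ.* k) as + powSum (2 ℕ.* k) as
mirror-powSum-even k as = trans (powSum-++ (2 ℕ.* k) as (map -_ as))
                                (cong (_+_ (powSum (2 ℕ.* k) as)) (powSum-neg-even k as))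

mirror-powSum-odd : ∀ k as → powSum (suc (2 ℕ.* k)) (mirror as) ≡ + 0
mirror-powSum-odd k as = begin
  powSum r (as ++ map -_ as)         ≡⟨ powSum-++ r as (map -_ as) ⟩
  powSum r as + powSum r (map -_ as) ≡⟨ cong (_+_ (powSum r as)) (powSum-neg-odd k as) ⟩
  powSum r as - powSum r as          ≡⟨ +-inverseʳ (powSum r as) ⟩
  + 0                                ∎
  where
  r : ℕ
  r = suc (2 ℕ.* k)

mirror-powSums-agree : ∀ as bs →
  powSum 2 as ≡ powSum 2 bs → powSum 4 as ≡ powSum 4 bs → powSum 6 as ≡ powSum 6 bs →
  ∀ r → 1 ≤ r → r ≤ 7 → powSum r (mirror as) ≡ powSum r (mirror bs)
mirror-powSums-agree as bs eq₂ eq₄ eq₆ = agree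
  where
  odd : ∀ k → powSum (suc (2 ℕ.* k)) (mirror as) ≡ powSum (suc (2 ℕ.* k)) (mirror bs)
  odd k = trans (mirror-powSum-odd k as) (sym (mirror-powSum-odd k bs))

  even : ∀ k → powSum (2 ℕ.* k) as ≡ powSum (2 ℕ.* k) bs →
         powSum (2 ℕ.* k) (mirror as) ≡ powSum (2 ℕ.* k) (mirror bs)
  even k eq = trans (mirror-powSum-even k as) (trans (cong₂ _+_ eq eq) (sym (mirror-powSum-even k bs)))

  agree : ∀ r → 1 ≤ r → r ≤ 7 → powSum r (mirror as) ≡ powSum r (mirror bs)
  agree 1 _ _ = odd 0
  agree 2 _ _ = even 1 eq₂
  agree 3 _ _ = odd 1
  agree 4 _ _ = even 2 eq₄
  agree 5 _ _ = odd 2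
  agree 6 _ _ = even 3 eq₆
  agree 7 _ _ = odd 3
  agree (suc (suc (suc (suc (suc (suc (suc (suc _))))))))
    _ (s≤s (s≤s (s≤s (s≤s (s≤s (s≤s (s≤s ())))))))

∈-∉⇒¬↭ : ∀ {x : ℤ} {xs ys} → x ∈ xs → x ∉ ys → ¬ (xs ↭ ys)
∈-∉⇒¬↭ x∈xs x∉ys xs↭ys = x∉ys (∈-resp-↭ xs↭ys x∈xs)

X₁ X₂ X₃ X₄ Y₁ Y₂ Y₃ Y₄ : Expr
X₁ = con (+ 2) :* var :^ 4 :+ con (+ 42) :* var :^ 3 :- con (+ 170) :* var :^ 2 :+ con (+ 942) :* var :- con (+ 48)
X₂ = var :^ 4 :- con (+ 84) :* var :^ 3 :- con (+ 242) :* var :^ 2 :- con (+ 68) :* var :- con (+ 1911)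
X₃ = con (+ 5) :* var :^ 4 :+ con (+ 12) :* var :^ 3 :- con (+ 10) :* var :^ 2 :+ con (+ 1724) :* var :+ con (+ 1341)
X₄ = con (+ 3) :* var :^ 4 :- con (+ 58) :* var :^ 3 :+ con (+ 92) :* var :^ 2 :- con (+ 310) :* var :- con (+ 1263)
Y₁ = con (+ 3) :* var :^ 4 :- con (+ 16) :* var :^ 3 :- con (+ 170) :* var :^ 2 :- con (+ 1320) :* var :- con (+ 1569)
Y₂ = con (+ 2) :* var :^ 4 :- con (+ 86) :* var :^ 3 :- con (+ 106) :* var :^ 2 :- con (+ 146) :* var :+ con (+ 1872)
Y₃ = con (+ 5) :* var :^ 4 :+ con (+ 10) :* var :^ 3 :+ con (+ 164) :* var :^ 2 :- con (+ 1562) :* var :- con (+ 921)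
Y₄ = var :^ 4 :+ con (+ 56) :* var :^ 3 :+ con (+ 266) :* var :^ 2 :+ con (+ 928) :* var :- con (+ 483)

-- ⟦ Xᵢ ⟧ t and ⟦ Yᵢ ⟧ t unfold to xᵢ t and yᵢ t, so xs4 and ys4 are these lists definitionally.
Xs Ys : List Expr
Xs = X₁ ∷ X₂ ∷ X₃ ∷ X₄ ∷ []
Ys = Y₁ ∷ Y₂ ∷ Y₃ ∷ Y₄ ∷ []

-- The coefficients are compared by deciding equality rather than by refl: the decision runs
-- in a single reduction with sharing, whereas checking refl re-evaluates the degree-24
-- products for every coefficient and exhausts memory.
four-term-powSums-agree : ∀ r → True (powSumₚ r (map normalise Xs) ≟ₚ powSumₚ r (map normalise Ys)) →
  ∀ t → powSum r (xs4 t) ≡ powSum r (ys4 t)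
four-term-powSums-agree r coeffs-agree = powSum-identity r Xs Ys (toWitness coeffs-agree)

mainTheorem3 :
    (∀ (t : ℤ) →
        powSum 2 (xs4 t) ≡ powSum 2 (ys4 t)
      × powSum 4 (xs4 t) ≡ powSum 4 (ys4 t)
      × powSum 6 (xs4 t) ≡ powSum 6 (ys4 t))
    × (∀ (t : ℤ) (r : ℕ) → 1 ≤ r → r ≤ 7 → powSum r (xs8 t) ≡ powSum r (ys8 t))
    × (∃[ t ] ¬ (xs8 t ↭ ys8 t))
mainTheorem3 = (λ t → agree₂ t , agree₄ t , agree₆ t) , eight-term , (+ 0 , distinct)
  where
  agree₂ : ∀ t → powSum 2 (xs4 t) ≡ powSum 2 (ys4 t)
  agree₂ = four-term-powSums-agree 2 _
  agree₄ : ∀ t → powSum 4 (xs4 t) ≡ powSum 4 (ys4 t)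
  agree₄ = four-term-powSums-agree 4 _
  agree₆ : ∀ t → powSum 6 (xs4 t) ≡ powSum 6 (ys4 t)
  agree₆ = four-term-powSums-agree 6 _

  eight-term : ∀ t r → 1 ≤ r → r ≤ 7 → powSum r (xs8 t) ≡ powSum r (ys8 t)
  eight-term t = mirror-powSums-agree (xs4 t) (ys4 t) (agree₂ t) (agree₄ t) (agree₆ t)

  distinct : ¬ (xs8 (+ 0) ↭ ys8 (+ 0))
  distinct = ∈-∉⇒¬↭ (here refl) (toWitnessFalse {a? = x₁ (+ 0) ∈? ys8 (+ 0)} _)
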